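{- For every unsatisfiable formula $\Gamma$, $\mathrm{size}_{\mathsf{SBC}^- }(\mathcal{G}(\Gamma))\ge \mathrm{size}_{\mathsf{SBC}^- }(\Gamma)$.
   Context: A literal is a variable $v$ or its negation $\bar v$. A clause is a nontautological set of literals; $\bot$ is the empty clause; a formula is a finite set of clauses; $\mathrm{var}(\Gamma)$ is its set of variables. For a set $L$ of literals, $\bar L=\{\bar\ell:\ell\in L\}$. $D$ is a weakening of $C$ if $C\subseteq D$. If $C\cup\{x\}$, $D\cup\{\bar x\}$ are clauses with $x,\bar x\notin C\cup D$ and $C\cup D$ nontautological, $C\cup D$ is their resolvent. For a clause $C$ and formula $\Delta$, $C\vee\Delta=\{C\cup D: D\in\Delta,\ C\cup D \text{ nontautological}\}$. Resolution proof of $\Gamma$: sequence of formulas $(\Gamma_1,\dots,\Gamma_N)$, $\Gamma_1=\Gamma$, $\bot\in\Gamma_N$, each $\Gamma_{i+1}=\Gamma_i\cup\{C\}$ with $C$ a resolvent of two clauses of $\Gamma_i$ or a weakening of a clause of $\Gamma_i$; size $N$. Set-blocked clause: $C$ is an SBC for nonempty $L\subseteq C$ w.r.t. $\Gamma$ if for every $D\in\Gamma$ with $D\cap\bar L\ne\varnothing$, $D\cap L=\varnothing$, the set $(C\setminus L)\cup(D\setminus\bar L)$ is tautological. An $\mathsf{SBC}$ proof is like a resolution proof but additionally allows adding a clause that is an SBC w.r.t. the current $\Gamma_i$; an $\mathsf{SBC}^-$ proof of $\Gamma$ is an $\mathsf{SBC}$ proof using only variables of $\mathrm{var}(\Gamma)$.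 For a proof system $P$, $\mathrm{size}_P(\Gamma)$ is the minimum size of a $P$-proof of $\Gamma$ ($\infty$ if $\Gamma$ is satisfiable). Extended resolution ($\mathsf{ER}$): for a formula $\Delta$, literals $p,q$ and a variable $x$ not occurring in $\Delta,p,q$, the set $\{\bar x\vee p,\ \bar x\vee q,\ x\vee\bar p\vee\bar q\}$ is a set of extension clauses for $\Delta$. $\Lambda$ is an extension for $\Gamma$ if $\Lambda=\bigcup_{i=1}^t\lambda_i$ where each $\lambda_i$ is a set of extension clauses for $\Gamma\cup\lambda_1\cup\dots\cup\lambda_{i-1}$. An $\mathsf{ER}$ proof of $\Gamma$ is a pair $(\Lambda,\Pi)$ with $\Lambda$ an extension for $\Gamma$ and $\Pi$ a resolution proof of $\Gamma\cup\Lambda$; size $|\Lambda|+|\Pi|$. Construction: for unsatisfiable $\Gamma$, fix a minimum-size $\mathsf{ER}$ proof $(\Lambda,\Pi)$ of $\Gamma$, where $\Lambda$ is the union of $t(\Gamma)=|\Lambda|/3$ sets $\lambda_i=\{\bar x_i\vee p_i,\ \bar x_i\vee q_i,\ x_i\vee\bar p_i\vee\bar q_i\}$ with extension variables $x_1,\dots,x_{t(\Gamma)}$ (not in $\mathrm{var}(\Gamma)$). Define $\mathcal{G}(\Gamma)=\Gamma\cup\bigcup_{i=1}^{t(\Gamma)}\big[(x_i\vee\Gamma)\cup(\bar x_i\vee\Gamma)\big]$. -}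

module Defs where

open import Data.Nat using (ℕ; suc; _+_; _*_; _≤_)
import Data.Nat.Properties as ℕP
open import Data.Bool using (Bool; true; false; not)
open import Data.List using (List; []; _∷_; _++_; [_]; _∷ʳ_; map; concatMap; filter; length)
open import Data.List.Membership.Propositional using (_∈_; _∉_; find; lose)
open import Data.List.Relation.Unary.All using (All)
open import Data.List.Relation.Unary.Any using (any?)
open import Data.Product using (Σ; ∃; _×_; _,_; proj₁)
open import Data.Sum using (_⊎_)
open import Relation.Nullary using (¬_; Dec; yes; no)
open import Relation.Nullary.Decidable using (¬?)
open import Relation.Binary.PropositionalEquality using (_≡_; _≢_; refl; cong)
open import Relation.Binary.Definitions using (DecidableEquality)

data Lit : Set where
  pos : ℕ → Lit
  neg : ℕ → Lit

var : Lit → ℕ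
var (pos v) = v
var (neg v) = v

compl : Lit → Lit
compl (pos v) = neg v
compl (neg v) = pos v

_≟L_ : DecidableEquality Lit
pos a ≟L pos b with a ℕP.≟ b
... | yes refl = yes refl
... | no ne = no λ { refl → ne refl }
pos a ≟L neg b = no λ ()
neg a ≟L pos b = no λ ()
neg a ≟L neg b with a ℕP.≟ b
... | yes refl = yes refl
... | no ne = no λ { refl → ne refl }

open import Data.List.Membership.DecPropositional _≟L_ using (_∈?_)

TautSet : (Lit → Set) → Set
TautSet S = ∃ λ ℓ → S ℓ × S (compl ℓ)

-- Clauses / formulas are represented by lists, read as the SETS of their
-- elements (order and repetitions are irrelevant to all notions below).
Clause : Set
Clause = List Lit

Formula : Set
Formula = List Clause

Taut : Clause → Set
Taut C = TautSet (_∈ C)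

taut? : (C : Clause) → Dec (Taut C)
taut? C with any? (λ ℓ → compl ℓ ∈? C) C
... | yes p with find p
...   | ℓ , ℓ∈ , c∈ = yes (ℓ , ℓ∈ , c∈)
taut? C | no ¬p = no λ { (ℓ , ℓ∈ , c∈) → ¬p (lose ℓ∈ c∈) }

IsClause : Clause → Set
IsClause C = ¬ Taut C

IsFormula : Formula → Set
IsFormula Γ = All IsClause Γ

_⊆c_ : Clause → Clause → Set
C ⊆c D = ∀ {ℓ} → ℓ ∈ C → ℓ ∈ D

VarOf : Formula → ℕ → Set
VarOf Γ x = ∃ λ C → C ∈ Γ × ∃ λ ℓ → ℓ ∈ C × var ℓ ≡ x

_∨F_ : Clause → Formula → Formula
C ∨F Δ = filter (λ E → ¬? (taut? E)) (map (C ++_) Δ)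

evalLit : (ℕ → Bool) → Lit → Bool
evalLit α (pos v) = α v
evalLit α (neg v) = not (α v)

Satisfiable : Formula → Set
Satisfiable Γ = ∃ λ (α : ℕ → Bool) → All (λ C → ∃ λ ℓ → ℓ ∈ C × evalLit α ℓ ≡ true) Γ

Unsatisfiable : Formula → Set
Unsatisfiable Γ = ¬ Satisfiable Γ

-- E is a resolvent of A = C ∪ {ℓ} and B = D ∪ {ℓ̄}  (E = C ∪ D, nontautological).
-- Since A, B are clauses, ℓ̄ ∉ A and ℓ ∉ B, so C = A ∖ {ℓ}, D = B ∖ {ℓ̄}.
Resolvent : Clause → Clause → Clause → Set
Resolvent A B E =
  IsClause E × Σ Lit λ ℓ → ℓ ∈ A × compl ℓ ∈ B ×
    (∀ m → (m ∈ E → (m ∈ A × m ≢ ℓ) ⊎ (m ∈ B × m ≢ compl ℓ))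
         × ((m ∈ A × m ≢ ℓ) ⊎ (m ∈ B × m ≢ compl ℓ) → m ∈ E))

data ResStep (Γ : Formula) (E : Clause) : Set where
  res  : ∀ {A B} → A ∈ Γ → B ∈ Γ → Resolvent A B E → ResStep Γ E
  weak : ∀ {D} → D ∈ Γ → IsClause E → D ⊆c E → ResStep Γ E

SetBlocked : Formula → List Lit → Clause → Set
SetBlocked Γ L C =
  IsClause C × (∃ λ ℓ → ℓ ∈ L) × L ⊆c C ×
  (∀ D → D ∈ Γ →
     (∃ λ ℓ → ℓ ∈ L × compl ℓ ∈ D) →
     (∀ ℓ → ℓ ∈ L → ℓ ∉ D) →
     TautSet (λ m → (m ∈ C × m ∉ L) ⊎ (m ∈ D × compl m ∉ L)))

data SBCStep (Γ : Formula) (E : Clause) : Set where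
  rstep : ResStep Γ E → SBCStep Γ E
  sbc   : ∀ L → SetBlocked Γ L E → SBCStep Γ E

SBC⁻Step : (V : ℕ → Set) → Formula → Clause → Set
SBC⁻Step V Γ E = SBCStep Γ E × (∀ ℓ → ℓ ∈ E → V (var ℓ))

data Derivation (Step : Formula → Clause → Set) (Γ : Formula) : Formula → ℕ → Set where
  start : Derivation Step Γ Γ 1
  step  : ∀ {Δ n C} → Derivation Step Γ Δ n → Step Δ C → Derivation Step Γ (Δ ∷ʳ C) (suc n)

ProofOfSize : (Formula → Clause → Set) → Formula → ℕ → Set
ProofOfSize Step Γ N = ∃ λ Δ → Derivation Step Γ Δ N × [] ∈ Δ

ResProof : Formula → ℕ → Set
ResProof = ProofOfSize ResStep

SBC⁻Proof : Formula → ℕ → Set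
SBC⁻Proof Γ = ProofOfSize (SBC⁻Step (VarOf Γ)) Γ

-- size_P(Γ) ≥ size_P(Γ')  (sizes are minima in ℕ ∪ {∞}):
-- every P-proof of Γ of size N yields a P-proof of Γ' of size ≤ N.
SizeGE : (Formula → ℕ → Set) → Formula → Formula → Set
SizeGE P Γ Γ' = ∀ N → P Γ N → ∃ λ M → M ≤ N × P Γ' M

-- (x , p , q) stands for {x̄ ∨ p , x̄ ∨ q , x ∨ p̄ ∨ q̄}.
ExtDef : Set
ExtDef = ℕ × Lit × Lit

extClauses : ExtDef → Formula
extClauses (x , p , q) =
  (neg x ∷ p ∷ []) ∷ (neg x ∷ q ∷ []) ∷ (pos x ∷ compl p ∷ compl q ∷ []) ∷ []

Ext : List ExtDef → Formula
Ext = concatMap extClauses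

-- We require p_i ≢ q_i and
-- p_i ≢ q̄_i so that λ_i consists of three distinct (nontautological) clauses.
data IsExtension (Γ : Formula) : List ExtDef → Set where
  []   : IsExtension Γ []
  _∷ʳ⟨_⟩ : ∀ {es x p q} → IsExtension Γ es →
         (¬ VarOf (Γ ++ Ext es) x) × var p ≢ x × var q ≢ x × p ≢ q × p ≢ compl q →
         IsExtension Γ (es ∷ʳ (x , p , q))

ERProof : Formula → List ExtDef → ℕ → Set
ERProof Γ es N = IsExtension Γ es × ResProof (Γ ++ Ext es) N

erSize : List ExtDef → ℕ → ℕ
erSize es N = 3 * length es + N

MinimumERProof : Formula → List ExtDef → ℕ → Set
MinimumERProof Γ es N =
  ERProof Γ es N × (∀ es' N' → ERProof Γ es' N' → erSize es N ≤ erSize es' N')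

𝒢 : Formula → List ExtDef → Formula
𝒢 Γ es = Γ ++ concatMap (λ e → ((pos (proj₁ e) ∷ []) ∨F Γ) ++ ((neg (proj₁ e) ∷ []) ∨F Γ)) es

-- Let X be the extension variables and ρ the partial assignment setting every x ∈ X to false.
-- Since Γ mentions no variable of X, restricting 𝒢(Γ) by ρ gives back Γ: the clauses x̄ ∨ C are
-- satisfied and the clauses x ∨ C restrict to C. Restricting every clause of an SBC⁻ proof of
-- 𝒢(Γ) by ρ and dropping the satisfied ones yields an SBC⁻ proof of Γ that is no longer:
-- resolution steps become resolution steps or weakenings, and a set-blocked clause stays
-- set-blocked for the same L, because L contains no literal over X. Indeed, if ℓ ∈ L had
-- var ℓ ∈ X, repairing an assignment falsifying the blocked clause by making L true would
-- satisfy every clause ℓ̄ ∨ C with C ∈ Γ, hence all of Γ.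
module Submission where

open import Defs
open import Data.Nat using (ℕ; suc; _≤_; s≤s; _≟_)
open import Data.Nat.Properties using (≤-refl; m≤n⇒m≤1+n)
open import Data.Bool using (Bool; true; false; not)
open import Data.Bool.Properties using (not-involutive)
open import Data.List using (List; []; _∷_; _++_; _∷ʳ_; map; filter)
open import Data.List.Membership.Propositional using (_∈_; _∉_; find; lose)
open import Data.List.Membership.Propositional.Properties
  using (∈-map⁺; ∈-map⁻; ∈-++⁺ˡ; ∈-++⁺ʳ; ∈-++⁻; ∈-filter⁺; ∈-filter⁻; ∈-concatMap⁺; ∈-concatMap⁻)
open import Data.List.Membership.DecPropositional _≟L_ using (_∈?_)
open import Data.List.Membership.DecPropositional _≟_ using () renaming (_∈?_ to _∈ℕ?_)
import Data.List.Relation.Unary.All as All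
open import Data.List.Relation.Unary.Any using (here; there; any?)
open import Data.Product using (∃; ∃₂; _×_; _,_; proj₁; proj₂)
open import Data.Sum using (_⊎_; inj₁; inj₂)
open import Data.Empty using (⊥; ⊥-elim)
open import Function using (_∘_)
open import Relation.Nullary using (¬_; Dec; yes; no; does)
open import Relation.Nullary.Decidable using (¬?)
open import Relation.Unary using (Decidable)
open import Relation.Binary.PropositionalEquality
  using (_≡_; _≢_; refl; sym; trans; cong; subst; module ≡-Reasoning)

compl-involutive : ∀ m → compl (compl m) ≡ m
compl-involutive (pos v) = refl
compl-involutive (neg v) = refl

var-compl : ∀ m → var (compl m) ≡ var m
var-compl (pos v) = refl
var-compl (neg v) = refl

evalLit-compl : ∀ α m → evalLit α (compl m) ≡ not (evalLit α m)
evalLit-compl α (pos v) = refl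
evalLit-compl α (neg v) = sym (not-involutive (α v))

∷-isClause : ∀ {ℓ C} → IsClause C → (∀ {m} → m ∈ C → var m ≢ var ℓ) → IsClause (ℓ ∷ C)
∷-isClause {pos v} _ _ (_ , here refl , here ())
∷-isClause {neg v} _ _ (_ , here refl , here ())
∷-isClause {ℓ} _ newVar (_ , here refl , there ℓ̄∈C) = newVar ℓ̄∈C (var-compl ℓ)
∷-isClause _ newVar (m , there m∈C , here m̄≡ℓ) =
  newVar m∈C (trans (sym (var-compl m)) (cong var m̄≡ℓ))
∷-isClause clC _ (m , there m∈C , there m̄∈C) = clC (m , m∈C , m̄∈C)

∈-∷ʳ⁻ : ∀ {A : Set} {x y : A} xs → x ∈ xs ∷ʳ y → x ∈ xs ⊎ x ≡ y
∈-∷ʳ⁻ xs x∈ with ∈-++⁻ xs x∈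
... | inj₁ x∈xs = inj₁ x∈xs
... | inj₂ (here x≡y) = inj₂ x≡y

nonTaut? : Decidable (¬_ ∘ Taut)
nonTaut? E = ¬? (taut? E)

∈-∨F⁺ : ∀ {C D Δ} → D ∈ Δ → IsClause (C ++ D) → (C ++ D) ∈ C ∨F Δ
∈-∨F⁺ {C} D∈Δ clCD = ∈-filter⁺ nonTaut? (∈-map⁺ (C ++_) D∈Δ) clCD

∈-∨F⁻ : ∀ {C E Δ} → E ∈ C ∨F Δ → ∃ λ D → D ∈ Δ × E ≡ C ++ D
∈-∨F⁻ {C} E∈ = ∈-map⁻ (C ++_) (proj₁ (∈-filter⁻ nonTaut? E∈))

derivation-⊇ : ∀ {Step Γ Δ n} → Derivation Step Γ Δ n → ∀ {C} → C ∈ Γ → C ∈ Δ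
derivation-⊇ start C∈ = C∈
derivation-⊇ (step d _) C∈ = ∈-++⁺ˡ (derivation-⊇ d C∈)

extension-fresh : ∀ {Γ es x} → IsExtension Γ es → x ∈ map proj₁ es → ¬ VarOf Γ x
extension-fresh [] ()
extension-fresh (_∷ʳ⟨_⟩ {es} ext (newVar , _)) x∈ x∈Γ with ∈-map⁻ proj₁ x∈
... | e , e∈ , refl with ∈-++⁻ es e∈
...   | inj₁ e∈es = extension-fresh ext (∈-map⁺ proj₁ e∈es) x∈Γ
...   | inj₂ (here refl) = let (C , C∈ , occ) = x∈Γ in newVar (C , ∈-++⁺ˡ C∈ , occ)

Satisfies : (ℕ → Bool) → Clause → Set
Satisfies α C = ∃ λ ℓ → ℓ ∈ C × evalLit α ℓ ≡ true

complementary-satisfies : ∀ α {D m} → m ∈ D → compl m ∈ D → Satisfies α D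
complementary-satisfies α {m = m} m∈ m̄∈ with evalLit α m in eq
... | true = m , m∈ , eq
... | false = compl m , m̄∈ , trans (evalLit-compl α m) (cong not eq)

falsifier : Clause → ℕ → Bool
falsifier C v = does (neg v ∈? C)

falsifier-falsifies : ∀ {C} → IsClause C → ∀ {m} → m ∈ C → evalLit (falsifier C) m ≡ false
falsifier-falsifies {C} clC {pos v} m∈ with neg v ∈? C
... | yes m̄∈ = ⊥-elim (clC (pos v , m∈ , m̄∈))
... | no _ = refl
falsifier-falsifies {C} clC {neg v} m∈ with neg v ∈? C
... | yes _ = refl
... | no m∉ = ⊥-elim (m∉ m∈)

override : (ℕ → Bool) → List Lit → ℕ → Bool
override α L v with pos v ∈? L | neg v ∈? L
... | yes _ | _ = true
... | no _ | yes _ = false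
... | no _ | no _ = α v

override-∈ : ∀ α {L} → ¬ Taut L → ∀ {ℓ} → ℓ ∈ L → evalLit (override α L) ℓ ≡ true
override-∈ α {L} _ {pos v} ℓ∈ with pos v ∈? L
... | yes _ = refl
... | no ℓ∉ = ⊥-elim (ℓ∉ ℓ∈)
override-∈ α {L} consistent {neg v} ℓ∈ with pos v ∈? L | neg v ∈? L
... | yes ℓ̄∈ | _ = ⊥-elim (consistent (pos v , ℓ̄∈ , ℓ∈))
... | no _ | yes _ = refl
... | no _ | no ℓ∉ = ⊥-elim (ℓ∉ ℓ∈)

override-∉ : ∀ α {L} m → m ∉ L → compl m ∉ L → evalLit (override α L) m ≡ evalLit α m
override-∉ α {L} (pos v) m∉ m̄∉ with pos v ∈? L | neg v ∈? L
... | yes m∈ | _ = ⊥-elim (m∉ m∈)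
... | no _ | yes m̄∈ = ⊥-elim (m̄∉ m̄∈)
... | no _ | no _ = refl
override-∉ α {L} (neg v) m∉ m̄∉ with pos v ∈? L | neg v ∈? L
... | yes m̄∈ | _ = ⊥-elim (m̄∉ m̄∈)
... | no _ | yes m∈ = ⊥-elim (m∉ m∈)
... | no _ | no _ = refl

setBlocked-consistent : ∀ {Δ L C} → SetBlocked Δ L C → ¬ Taut L
setBlocked-consistent (clC , _ , L⊆C , _) (ℓ , ℓ∈ , ℓ̄∈) = clC (ℓ , L⊆C ℓ∈ , L⊆C ℓ̄∈)

repair : Clause → List Lit → ℕ → Bool
repair C L = override (falsifier C) L

-- The usual argument that adding a set-blocked clause preserves satisfiability.
setBlocked-repair-satisfies : ∀ {Δ L C} → (b : SetBlocked Δ L C) → ∀ {D} → D ∈ Δ →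
                              (∃ λ ℓ → ℓ ∈ L × compl ℓ ∈ D) → Satisfies (repair C L) D
setBlocked-repair-satisfies {L = L} {C} b@(clC , _ , L⊆C , blocked) {D} D∈ meets
  with any? (_∈? D) L
... | yes hit = let (ℓ , ℓ∈L , ℓ∈D) = find hit in
                ℓ , ℓ∈D , override-∈ (falsifier C) (setBlocked-consistent b) ℓ∈L
... | no miss = fromTautology (blocked D D∈ meets λ ℓ ℓ∈L ℓ∈D → miss (lose ℓ∈L ℓ∈D))
  where
  open ≡-Reasoning
  fromC : ∀ {c} → c ∈ C → c ∉ L → compl c ∈ D → Satisfies (repair C L) D
  fromC {c} c∈C c∉L c̄∈D = compl c , c̄∈D , (begin
    evalLit (repair C L) (compl c)
      ≡⟨ override-∉ (falsifier C) (compl c) (λ c̄∈L → clC (c , c∈C , L⊆C c̄∈L))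
                                  (subst (_∉ L) (sym (compl-involutive c)) c∉L) ⟩
    evalLit (falsifier C) (compl c) ≡⟨ evalLit-compl (falsifier C) c ⟩
    not (evalLit (falsifier C) c)   ≡⟨ cong not (falsifier-falsifies clC c∈C) ⟩
    true                            ∎)
  fromTautology : TautSet (λ m → (m ∈ C × m ∉ L) ⊎ (m ∈ D × compl m ∉ L)) → Satisfies (repair C L) D
  fromTautology (m , inj₁ (m∈C , _) , inj₁ (m̄∈C , _)) = ⊥-elim (clC (m , m∈C , m̄∈C))
  fromTautology (m , inj₁ (m∈C , m∉L) , inj₂ (m̄∈D , _)) = fromC m∈C m∉L m̄∈D
  fromTautology (m , inj₂ (m∈D , m̄∉L) , inj₁ (m̄∈C , _)) =
    fromC m̄∈C m̄∉L (subst (_∈ D) (sym (compl-involutive m)) m∈D)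
  fromTautology (m , inj₂ (m∈D , _) , inj₂ (m̄∈D , _)) = complementary-satisfies (repair C L) m∈D m̄∈D

module Restriction (X : List ℕ) where

  FalseLit : Lit → Set
  FalseLit (pos v) = v ∈ X
  FalseLit (neg v) = ⊥

  TrueLit : Lit → Set
  TrueLit m = FalseLit (compl m)

  falseLit? : Decidable FalseLit
  falseLit? (pos v) = v ∈ℕ? X
  falseLit? (neg v) = no λ ()

  FalseLit⇒¬TrueLit : ∀ {m} → FalseLit m → ¬ TrueLit m
  FalseLit⇒¬TrueLit {pos v} _ ()

  FalseLit⇒TrueLit-compl : ∀ {m} → FalseLit m → TrueLit (compl m)
  FalseLit⇒TrueLit-compl {pos v} f = f

  TrueLit-compl⇒FalseLit : ∀ {m} → TrueLit (compl m) → FalseLit m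
  TrueLit-compl⇒FalseLit {pos v} t = t

  var∈X⇒FalseLit⊎TrueLit : ∀ m → var m ∈ X → FalseLit m ⊎ TrueLit m
  var∈X⇒FalseLit⊎TrueLit (pos v) v∈X = inj₁ v∈X
  var∈X⇒FalseLit⊎TrueLit (neg v) v∈X = inj₂ v∈X

  Sat : Clause → Set
  Sat C = ∃ λ m → m ∈ C × TrueLit m

  sat? : Decidable Sat
  sat? C with any? (falseLit? ∘ compl) C
  ... | yes hit = yes (find hit)
  ... | no miss = no λ { (m , m∈ , t) → miss (lose m∈ t) }

  restrict : Clause → Clause
  restrict = filter (¬? ∘ falseLit?)

  record RestrictsTo (D D' : Clause) : Set where
    field
      sound    : ∀ {m} → m ∈ D' → m ∈ D × ¬ FalseLit m
      complete : ∀ {m} → m ∈ D → ¬ FalseLit m → m ∈ D'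
  open RestrictsTo

  restrict-restricts : ∀ C → RestrictsTo C (restrict C)
  restrict-restricts C = record { sound = ∈-filter⁻ (¬? ∘ falseLit?) ; complete = ∈-filter⁺ (¬? ∘ falseLit?) }

  restrict-isClause : ∀ {C} → IsClause C → IsClause (restrict C)
  restrict-isClause {C} clC (m , m∈ , m̄∈) =
    clC (m , proj₁ (sound (restrict-restricts C) m∈) , proj₁ (sound (restrict-restricts C) m̄∈))

  restrict-avoids-X : ∀ {C ℓ} → ¬ Sat C → ℓ ∈ restrict C → ¬ var ℓ ∈ X
  restrict-avoids-X {C} {ℓ} ¬sC ℓ∈ x∈X with sound (restrict-restricts C) ℓ∈ | var∈X⇒FalseLit⊎TrueLit ℓ x∈X
  ... | _ , ¬fℓ | inj₁ fℓ = ¬fℓ fℓ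
  ... | ℓ∈C , _ | inj₂ tℓ = ¬sC (ℓ , ℓ∈C , tℓ)

  FalseLit⇒var∈X : ∀ {m} → FalseLit m → var m ∈ X
  FalseLit⇒var∈X {pos v} f = f

  TrueLit⇒var∈X : ∀ {m} → TrueLit m → var m ∈ X
  TrueLit⇒var∈X {neg v} t = t

  AvoidsX : Clause → Set
  AvoidsX C = ∀ {m} → m ∈ C → ¬ var m ∈ X

  avoidsX-¬Sat : ∀ {C} → AvoidsX C → ¬ Sat C
  avoidsX-¬Sat avoids (_ , m∈ , tm) = avoids m∈ (TrueLit⇒var∈X tm)

  avoidsX-restrictsTo-self : ∀ {C} → AvoidsX C → RestrictsTo C C
  avoidsX-restrictsTo-self avoids = record
    { sound = λ m∈ → m∈ , avoids m∈ ∘ FalseLit⇒var∈X ; complete = λ m∈ _ → m∈ }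

  restrictsTo-∷-false : ∀ {ℓ C} → FalseLit ℓ → AvoidsX C → RestrictsTo (ℓ ∷ C) C
  restrictsTo-∷-false fℓ avoids = record
    { sound    = λ m∈ → there m∈ , avoids m∈ ∘ FalseLit⇒var∈X
    ; complete = λ { (here refl) ¬fℓ → ⊥-elim (¬fℓ fℓ) ; (there m∈) _ → m∈ } }

  restrictsTo-[] : ∀ {D'} → RestrictsTo [] D' → D' ≡ []
  restrictsTo-[] {[]} _ = refl
  restrictsTo-[] {m ∷ _} r with sound r (here refl)
  ... | () , _

  record Simulates (Δ Γ' : Formula) : Set where
    field
      covered : ∀ {D} → D ∈ Δ → Sat D ⊎ ∃ λ D' → D' ∈ Γ' × RestrictsTo D D'
      origin  : ∀ {D'} → D' ∈ Γ' → ∃ λ D → D ∈ Δ × ¬ Sat D × RestrictsTo D D'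
  open Simulates

  simulates-∷ʳ-sat : ∀ {Δ Γ' C} → Simulates Δ Γ' → Sat C → Simulates (Δ ∷ʳ C) Γ'
  covered (simulates-∷ʳ-sat {Δ} sim sC) D∈ with ∈-∷ʳ⁻ Δ D∈
  ... | inj₁ D∈Δ = covered sim D∈Δ
  ... | inj₂ refl = inj₁ sC
  origin (simulates-∷ʳ-sat sim _) D'∈ = let (D , D∈ , rest) = origin sim D'∈ in D , ∈-++⁺ˡ D∈ , rest

  simulates-∷ʳ-restrict : ∀ {Δ Γ' C} → Simulates Δ Γ' → ¬ Sat C →
                          Simulates (Δ ∷ʳ C) (Γ' ∷ʳ restrict C)
  covered (simulates-∷ʳ-restrict {Δ} {Γ'} sim _) D∈ with ∈-∷ʳ⁻ Δ D∈
  ... | inj₂ refl = inj₂ (_ , ∈-++⁺ʳ Γ' (here refl) , restrict-restricts _)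
  ... | inj₁ D∈Δ with covered sim D∈Δ
  ...   | inj₁ sD = inj₁ sD
  ...   | inj₂ (D' , D'∈ , r) = inj₂ (D' , ∈-++⁺ˡ D'∈ , r)
  origin (simulates-∷ʳ-restrict {Δ} {Γ'} {C} sim ¬sC) D'∈ with ∈-∷ʳ⁻ Γ' D'∈
  ... | inj₁ D'∈Γ' = let (D , D∈ , rest) = origin sim D'∈Γ' in D , ∈-++⁺ˡ D∈ , rest
  ... | inj₂ refl = C , ∈-++⁺ʳ Δ (here refl) , ¬sC , restrict-restricts C

  restricted-premise : ∀ {Δ Γ' D} → Simulates Δ Γ' → D ∈ Δ → ¬ Sat D →
                       ∃ λ D' → D' ∈ Γ' × RestrictsTo D D'
  restricted-premise sim D∈ ¬sD with covered sim D∈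
  ... | inj₁ sD = ⊥-elim (¬sD sD)
  ... | inj₂ restricted = restricted

  restricted-weakening : ∀ {Γ' C D D'} → IsClause C → D' ∈ Γ' → RestrictsTo D D' →
                         (∀ {m} → m ∈ D → ¬ FalseLit m → m ∈ C) → ResStep Γ' (restrict C)
  restricted-weakening {C = C} clC D'∈ r D⊆C = weak D'∈ (restrict-isClause clC) λ m∈D' →
    let (m∈D , ¬fm) = sound r m∈D' in complete (restrict-restricts C) (D⊆C m∈D ¬fm) ¬fm

  resolvent-restrict : ∀ {Δ Γ' A B C} → Simulates Δ Γ' → ¬ Sat C → A ∈ Δ → B ∈ Δ →
                       Resolvent A B C → ResStep Γ' (restrict C)
  resolvent-restrict {Γ' = Γ'} {A} {B} {C} sim ¬sC A∈ B∈ (clC , ℓ , ℓ∈A , ℓ̄∈B , splits) =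
    byPivot (falseLit? ℓ) (falseLit? (compl ℓ))
    where
    fromA : ∀ {m} → m ∈ A → m ≢ ℓ → m ∈ C
    fromA m∈A m≢ℓ = proj₂ (splits _) (inj₁ (m∈A , m≢ℓ))
    fromB : ∀ {m} → m ∈ B → m ≢ compl ℓ → m ∈ C
    fromB m∈B m≢ℓ̄ = proj₂ (splits _) (inj₂ (m∈B , m≢ℓ̄))
    ¬Sat-A : ¬ TrueLit ℓ → ¬ Sat A
    ¬Sat-A ¬tℓ (m , m∈A , tm) = ¬sC (m , fromA m∈A (λ { refl → ¬tℓ tm }) , tm)
    ¬Sat-B : ¬ TrueLit (compl ℓ) → ¬ Sat B
    ¬Sat-B ¬tℓ̄ (m , m∈B , tm) = ¬sC (m , fromB m∈B (λ { refl → ¬tℓ̄ tm }) , tm)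
    byPivot : Dec (FalseLit ℓ) → Dec (FalseLit (compl ℓ)) → ResStep Γ' (restrict C)
    byPivot (yes fℓ) _ with restricted-premise sim A∈ (¬Sat-A (FalseLit⇒¬TrueLit fℓ))
    ... | A' , A'∈ , rA = restricted-weakening clC A'∈ rA λ m∈A ¬fm → fromA m∈A λ { refl → ¬fm fℓ }
    byPivot (no _) (yes fℓ̄) with restricted-premise sim B∈ (¬Sat-B (FalseLit⇒¬TrueLit fℓ̄))
    ... | B' , B'∈ , rB = restricted-weakening clC B'∈ rB λ m∈B ¬fm → fromB m∈B λ { refl → ¬fm fℓ̄ }
    byPivot (no ¬fℓ) (no ¬fℓ̄)
      with restricted-premise sim A∈ (¬Sat-A ¬fℓ̄)
         | restricted-premise sim B∈ (¬Sat-B (¬fℓ ∘ TrueLit-compl⇒FalseLit))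
    ... | A' , A'∈ , rA | B' , B'∈ , rB =
      res A'∈ B'∈ (restrict-isClause clC , ℓ , complete rA ℓ∈A ¬fℓ , complete rB ℓ̄∈B ¬fℓ̄ ,
                   λ m → toPremises , fromPremises)
      where
      toPremises : ∀ {m} → m ∈ restrict C → (m ∈ A' × m ≢ ℓ) ⊎ (m ∈ B' × m ≢ compl ℓ)
      toPremises {m} m∈ with sound (restrict-restricts C) m∈
      ... | m∈C , ¬fm with proj₁ (splits m) m∈C
      ...   | inj₁ (m∈A , m≢ℓ) = inj₁ (complete rA m∈A ¬fm , m≢ℓ)
      ...   | inj₂ (m∈B , m≢ℓ̄) = inj₂ (complete rB m∈B ¬fm , m≢ℓ̄)
      fromPremises : ∀ {m} → (m ∈ A' × m ≢ ℓ) ⊎ (m ∈ B' × m ≢ compl ℓ) → m ∈ restrict C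
      fromPremises (inj₁ (m∈A' , m≢ℓ)) =
        let (m∈A , ¬fm) = sound rA m∈A' in complete (restrict-restricts C) (fromA m∈A m≢ℓ) ¬fm
      fromPremises (inj₂ (m∈B' , m≢ℓ̄)) =
        let (m∈B , ¬fm) = sound rB m∈B' in complete (restrict-restricts C) (fromB m∈B m≢ℓ̄) ¬fm

  resStep-restrict : ∀ {Δ Γ' C} → Simulates Δ Γ' → ¬ Sat C → ResStep Δ C → ResStep Γ' (restrict C)
  resStep-restrict sim ¬sC (res A∈ B∈ resolvent) = resolvent-restrict sim ¬sC A∈ B∈ resolvent
  resStep-restrict sim ¬sC (weak D∈ clC D⊆C)
    with restricted-premise sim D∈ (λ { (m , m∈D , tm) → ¬sC (m , D⊆C m∈D , tm) })
  ... | D' , D'∈ , r = restricted-weakening clC D'∈ r λ m∈D _ → D⊆C m∈D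

  setBlocked-restrict : ∀ {Δ Γ' L C} → Simulates Δ Γ' → ¬ Sat C → (∀ {ℓ} → ℓ ∈ L → ¬ FalseLit ℓ) →
                        SetBlocked Δ L C → SetBlocked Γ' L (restrict C)
  setBlocked-restrict {Γ' = Γ'} {L} {C} sim ¬sC L-unfalsified (clC , L≢∅ , L⊆C , blocked) =
    restrict-isClause clC , L≢∅ , (λ ℓ∈L → complete (restrict-restricts C) (L⊆C ℓ∈L) (L-unfalsified ℓ∈L)) ,
    blocked'
    where
    blocked' : ∀ D' → D' ∈ Γ' → (∃ λ ℓ → ℓ ∈ L × compl ℓ ∈ D') → (∀ ℓ → ℓ ∈ L → ℓ ∉ D') →
               TautSet (λ m → (m ∈ restrict C × m ∉ L) ⊎ (m ∈ D' × compl m ∉ L))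
    blocked' D' D'∈ (k , k∈L , k̄∈D') D'∩L≡∅ with origin sim D'∈
    ... | D , D∈ , ¬sD , r
      with blocked D D∈ (k , k∈L , proj₁ (sound r k̄∈D'))
                   (λ j j∈L j∈D → D'∩L≡∅ j j∈L (complete r j∈D (L-unfalsified j∈L)))
    ...   | m , m-side , m̄-side =
      m , transfer (¬true m̄-side ∘ FalseLit⇒TrueLit-compl) m-side , transfer (¬true m-side) m̄-side
      where
      ¬true : ∀ {n} → (n ∈ C × n ∉ L) ⊎ (n ∈ D × compl n ∉ L) → ¬ TrueLit n
      ¬true (inj₁ (n∈C , _)) tn = ¬sC (_ , n∈C , tn)
      ¬true (inj₂ (n∈D , _)) tn = ¬sD (_ , n∈D , tn)
      transfer : ∀ {n} → ¬ FalseLit n → (n ∈ C × n ∉ L) ⊎ (n ∈ D × compl n ∉ L) →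
                 (n ∈ restrict C × n ∉ L) ⊎ (n ∈ D' × compl n ∉ L)
      transfer ¬fn (inj₁ (n∈C , n∉L)) = inj₁ (complete (restrict-restricts C) n∈C ¬fn , n∉L)
      transfer ¬fn (inj₂ (n∈D , n̄∉L)) = inj₂ (complete r n∈D ¬fn , n̄∉L)

module Simulation (Γ : Formula) (es : List ExtDef) (isF : IsFormula Γ) (unsat : Unsatisfiable Γ)
                  (fresh : ∀ {x} → x ∈ map proj₁ es → ¬ VarOf Γ x) where

  X : List ℕ
  X = map proj₁ es

  open Restriction X
  open RestrictsTo
  open Simulates

  G : Formula
  G = 𝒢 Γ es

  cases : ExtDef → Formula
  cases e = ((pos (proj₁ e) ∷ []) ∨F Γ) ++ ((neg (proj₁ e) ∷ []) ∨F Γ)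

  fresh-∷-isClause : ∀ {ℓ C} → var ℓ ∈ X → C ∈ Γ → IsClause (ℓ ∷ C)
  fresh-∷-isClause x∈X C∈ =
    ∷-isClause (All.lookup isF C∈) λ m∈ m≡ℓ → fresh x∈X (_ , C∈ , _ , m∈ , m≡ℓ)

  compl-∷-∈-𝒢 : ∀ ℓ {C} → var ℓ ∈ X → C ∈ Γ → (compl ℓ ∷ C) ∈ G
  compl-∷-∈-𝒢 ℓ x∈X C∈ with ∈-map⁻ proj₁ x∈X
  compl-∷-∈-𝒢 (pos x) x∈X C∈ | e , e∈ , refl =
    ∈-++⁺ʳ Γ (∈-concatMap⁺ cases (lose e∈ (∈-++⁺ʳ ((pos x ∷ []) ∨F Γ) (∈-∨F⁺ C∈ (fresh-∷-isClause x∈X C∈)))))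
  compl-∷-∈-𝒢 (neg x) x∈X C∈ | e , e∈ , refl =
    ∈-++⁺ʳ Γ (∈-concatMap⁺ cases (lose e∈ (∈-++⁺ˡ (∈-∨F⁺ C∈ (fresh-∷-isClause x∈X C∈)))))

  data 𝒢-Clause (D : Clause) : Set where
    original : D ∈ Γ → 𝒢-Clause D
    guarded  : ∀ {ℓ C} → var ℓ ∈ X → C ∈ Γ → D ≡ ℓ ∷ C → 𝒢-Clause D

  ∈-𝒢⁻ : ∀ {D} → D ∈ G → 𝒢-Clause D
  ∈-𝒢⁻ D∈ with ∈-++⁻ Γ D∈
  ... | inj₁ D∈Γ = original D∈Γ
  ... | inj₂ D∈⋃ with find (∈-concatMap⁻ cases D∈⋃)
  ...   | e , e∈ , D∈cases with ∈-++⁻ ((pos (proj₁ e) ∷ []) ∨F Γ) D∈cases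
  ...     | inj₁ D∈pos = let (C , C∈ , D≡) = ∈-∨F⁻ D∈pos in guarded (∈-map⁺ proj₁ e∈) C∈ D≡
  ...     | inj₂ D∈neg = let (C , C∈ , D≡) = ∈-∨F⁻ D∈neg in guarded (∈-map⁺ proj₁ e∈) C∈ D≡

  VarOf-𝒢 : ∀ {v} → VarOf G v → ¬ v ∈ X → VarOf Γ v
  VarOf-𝒢 (D , D∈ , m , m∈ , refl) v∉X with ∈-𝒢⁻ D∈
  ... | original D∈Γ = D , D∈Γ , m , m∈ , refl
  ... | guarded x∈X C∈ refl with m∈
  ...   | here refl = ⊥-elim (v∉X x∈X)
  ...   | there m∈C = _ , C∈ , m , m∈C , refl

  Γ-avoids-X : ∀ {C} → C ∈ Γ → AvoidsX C
  Γ-avoids-X C∈ m∈ x∈X = fresh x∈X (_ , C∈ , _ , m∈ , refl)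

  𝒢-simulates-Γ : Simulates G Γ
  covered 𝒢-simulates-Γ D∈ with ∈-𝒢⁻ D∈
  ... | original D∈Γ = inj₂ (_ , D∈Γ , avoidsX-restrictsTo-self (Γ-avoids-X D∈Γ))
  ... | guarded {ℓ} x∈X C∈ refl with var∈X⇒FalseLit⊎TrueLit ℓ x∈X
  ...   | inj₁ fℓ = inj₂ (_ , C∈ , restrictsTo-∷-false fℓ (Γ-avoids-X C∈))
  ...   | inj₂ tℓ = inj₁ (ℓ , here refl , tℓ)
  origin 𝒢-simulates-Γ D∈Γ =
    _ , ∈-++⁺ˡ D∈Γ , avoidsX-¬Sat (Γ-avoids-X D∈Γ) , avoidsX-restrictsTo-self (Γ-avoids-X D∈Γ)

  blocking-avoids-X : ∀ {Δ L C ℓ} → (∀ {D} → D ∈ G → D ∈ Δ) → SetBlocked Δ L C → ℓ ∈ L → ¬ var ℓ ∈ X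
  blocking-avoids-X {L = L} {C} {ℓ} G⊆Δ b ℓ∈L x∈X = unsat (repair C L , All.tabulate satisfies)
    where
    ℓ-true : evalLit (repair C L) ℓ ≡ true
    ℓ-true = override-∈ (falsifier C) (setBlocked-consistent b) ℓ∈L
    satisfies : ∀ {C₀} → C₀ ∈ Γ → Satisfies (repair C L) C₀
    satisfies C₀∈ with setBlocked-repair-satisfies b (G⊆Δ (compl-∷-∈-𝒢 ℓ x∈X C₀∈)) (ℓ , ℓ∈L , here refl)
    ... | m , there m∈C₀ , tm = m , m∈C₀ , tm
    ... | _ , here refl , tℓ̄ with trans (sym tℓ̄) (trans (evalLit-compl (repair C L) ℓ) (cong not ℓ-true))
    ...   | ()

  sbc⁻Step-restrict : ∀ {Δ Γ' C} → (∀ {D} → D ∈ G → D ∈ Δ) → Simulates Δ Γ' → ¬ Sat C →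
                      SBC⁻Step (VarOf G) Δ C → SBC⁻Step (VarOf Γ) Γ' (restrict C)
  sbc⁻Step-restrict {C = C} G⊆Δ sim ¬sC (st , varsC) = step-restrict st , vars
    where
    step-restrict : SBCStep _ C → SBCStep _ (restrict C)
    step-restrict (rstep r) = rstep (resStep-restrict sim ¬sC r)
    step-restrict (sbc L b) =
      sbc L (setBlocked-restrict sim ¬sC (λ ℓ∈L → blocking-avoids-X G⊆Δ b ℓ∈L ∘ FalseLit⇒var∈X) b)
    vars : ∀ ℓ → ℓ ∈ restrict C → VarOf Γ (var ℓ)
    vars ℓ ℓ∈ = VarOf-𝒢 (varsC ℓ (proj₁ (sound (restrict-restricts C) ℓ∈))) (restrict-avoids-X ¬sC ℓ∈)

  SimulatedBelow : Formula → ℕ → Set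
  SimulatedBelow Δ n =
    ∃₂ λ Γ' M → M ≤ n × Derivation (SBC⁻Step (VarOf Γ)) Γ Γ' M × Simulates Δ Γ'

  simulate : ∀ {Δ n} → Derivation (SBC⁻Step (VarOf G)) G Δ n → SimulatedBelow Δ n
  simulate start = Γ , 1 , ≤-refl , start , 𝒢-simulates-Γ
  simulate (step {C = C} d st) with simulate d | sat? C
  ... | Γ' , M , M≤n , d' , sim | yes sC = Γ' , M , m≤n⇒m≤1+n M≤n , d' , simulates-∷ʳ-sat sim sC
  ... | Γ' , M , M≤n , d' , sim | no ¬sC =
    Γ' ∷ʳ restrict C , suc M , s≤s M≤n ,
    step d' (sbc⁻Step-restrict (derivation-⊇ d) sim ¬sC st) , simulates-∷ʳ-restrict sim ¬sC

  proof-size-≥ : SizeGE SBC⁻Proof G Γ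
  proof-size-≥ N (Δ , d , ⊥∈Δ) with simulate d
  ... | Γ' , M , M≤N , d' , sim with covered sim ⊥∈Δ
  ...   | inj₁ (_ , () , _)
  ...   | inj₂ (D' , D'∈ , r) = M , M≤N , Γ' , d' , subst (_∈ Γ') (restrictsTo-[] r) D'∈

lemma23 : (Γ : Formula) → IsFormula Γ → Unsatisfiable Γ →
    (es : List ExtDef) (N : ℕ) → MinimumERProof Γ es N →
    SizeGE SBC⁻Proof (𝒢 Γ es) Γ
lemma23 Γ isF unsat es _ ((ext , _) , _) =
  Simulation.proof-size-≥ Γ es isF unsat (extension-fresh ext)
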